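{- Let $1\le M\le N$ be integers and let $r_{M,N}(n)$ be the number of sequences $(\boldsymbol{w}_1,\ldots,\boldsymbol{w}_n)$ of vectors in $\mathcal{V}_{M,N}$ with $\boldsymbol{w}_1+\cdots+\boldsymbol{w}_n=\boldsymbol{0}$. If $M$ is odd or $M=N$, then $r_{M,N}(2n+1)=0$ for all integers $n\ge 0$.
   Context: $\mathcal{V}_{M,N}=\{(v_1,\ldots,v_N)\in\{ -1,0,1\}^N : |v_1|+\cdots+|v_N|=M\}$. Equivalently, $r_{M,N}(n)$ is the constant term (coefficient of $X_1^0\cdots X_N^0$) of the Laurent polynomial $\big(\sigma_M(Y_1,\ldots,Y_N)\big)^n$, where $Y_j=X_j+X_j^{ -1}$ and $\sigma_M$ is the $M$-th elementary symmetric polynomial in $N$ variables. -}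

module Defs where

open import Data.Nat using (ℕ; zero; suc)
open import Data.Integer using (ℤ; +_; -_; ∣_∣) renaming (_+_ to _+ℤ_)
open import Data.List using (List; []; _∷_; concatMap; map; filter; length; foldr)
open import Data.Vec using (Vec; []; _∷_; replicate; zipWith)
import Data.Vec as Vec
open import Data.Nat using (_≟_)
open import Data.Integer using () renaming (_≟_ to _≟ℤ_)
open import Relation.Nullary.Decidable using (Dec)
import Data.Vec.Properties as VP

trits : List ℤ
trits = - (+ 1) ∷ + 0 ∷ + 1 ∷ []

allTritVecs : (N : ℕ) → List (Vec ℤ N)
allTritVecs zero = [] ∷ []
allTritVecs (suc N) = concatMap (λ x → map (x ∷_) (allTritVecs N)) trits

weight : ∀ {N} → Vec ℤ N → ℕ
weight v = Vec.sum (Vec.map ∣_∣ v)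

-- 𝒱_{M,N} = { v ∈ {-1,0,1}^N : |v_1|+...+|v_N| = M }, as a duplicate-free list
𝒱 : (M N : ℕ) → List (Vec ℤ N)
𝒱 M N = filter (λ v → weight v ≟ M) (allTritVecs N)

sequences : ∀ {A : Set} → List A → (n : ℕ) → List (List A)
sequences xs zero = [] ∷ []
sequences xs (suc n) = concatMap (λ x → map (x ∷_) (sequences xs n)) xs

vsum : ∀ {N} → List (Vec ℤ N) → Vec ℤ N
vsum {N} = foldr (zipWith _+ℤ_) (replicate N (+ 0))

r : (M N n : ℕ) → ℕ
r M N n = length (filter (λ ws → VP.≡-dec _≟ℤ_ (vsum ws) (replicate N (+ 0))) (sequences (𝒱 M N) n))

{-# OPTIONS --safe #-}
-- A homomorphism χ : ℤᴺ → ℤ/2 that is 1 on every vector of 𝒱 forbids zero sums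
-- of odd length: χ (w₁ + ⋯ + w₂ₙ₊₁) = 2n + 1 = 1, whereas χ 0 = 0. If M is odd,
-- take χ v = v₁ + ⋯ + v_N mod 2, which equals |v₁| + ⋯ + |v_N| = M mod 2 on 𝒱.
-- If M = N, every coordinate of a vector in 𝒱 is ±1, so take χ v = v₁ mod 2.
module Submission where

open import Defs
open import Data.Nat using (ℕ; _≤_; _+_; _*_)
open import Data.Product using (∃)
open import Data.Sum using (_⊎_)
open import Relation.Binary.PropositionalEquality using (_≡_)

open import Data.Nat using (zero; suc; _∸_; z≤n; s≤s; parity)
open import Data.Nat.Properties
  using (≤-refl; ≤-total; ≤-antisym; +-suc; +-mono-≤; +-cancelʳ-≤; m∸n+n≡m; module ≤-Reasoning)
open import Data.Parity.Base as ℙ using (Parity; 0ℙ; 1ℙ)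
open import Data.Parity.Properties as ℙₚ using (+-homo-+; *-homo-*)
open import Algebra.Properties.CommutativeSemigroup ℙₚ.+-commutativeSemigroup using (interchange)
open import Data.Integer as ℤ using (ℤ; +_; -[1+_]; _⊖_; ∣_∣)
open import Data.Integer.Properties using (∣⊖∣-≤; ∣m⊖n∣≡∣n⊖m∣)
open import Data.Product using (_,_)
open import Data.Sum using (inj₁; inj₂)
open import Data.List using (List; []; _∷_; map; concatMap; length)
open import Data.List.Properties using (filter-none)
open import Data.List.Relation.Unary.All as All using (All; []; _∷_)
open import Data.List.Relation.Unary.All.Properties using (concat⁺; map⁺; all-filter; filter⁺)
open import Data.Vec using (Vec; []; _∷_; head; replicate; zipWith)
open import Data.Vec.Relation.Unary.All as VecAll using ([]; _∷_)
open import Relation.Nullary using (¬_)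
open import Relation.Binary.PropositionalEquality using (refl; sym; trans; cong; cong₂; module ≡-Reasoning)

parityℤ : ℤ → Parity
parityℤ i = parity ∣ i ∣

parity-∸ : ∀ {m n} → m ≤ n → parity (n ∸ m) ≡ parity n ℙ.+ parity m
parity-∸ {m} {n} m≤n = begin
  parity (n ∸ m)                                ≡⟨ sym (ℙₚ.+-identityʳ _) ⟩
  parity (n ∸ m) ℙ.+ 0ℙ                         ≡⟨ cong (parity (n ∸ m) ℙ.+_) (sym (ℙₚ.p+p≡0ℙ (parity m))) ⟩
  parity (n ∸ m) ℙ.+ (parity m ℙ.+ parity m)    ≡⟨ sym (ℙₚ.+-assoc (parity (n ∸ m)) _ _) ⟩
  parity (n ∸ m) ℙ.+ parity m ℙ.+ parity m      ≡⟨ cong (ℙ._+ parity m) (sym (+-homo-+ (n ∸ m) m)) ⟩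
  parity (n ∸ m + m) ℙ.+ parity m               ≡⟨ cong (λ k → parity k ℙ.+ parity m) (m∸n+n≡m m≤n) ⟩
  parity n ℙ.+ parity m                         ∎
  where open ≡-Reasoning

parity-∣⊖∣ : ∀ m n → parity ∣ m ⊖ n ∣ ≡ parity m ℙ.+ parity n
parity-∣⊖∣ m n with ≤-total m n
... | inj₁ m≤n = trans (cong parity (∣⊖∣-≤ m≤n)) (trans (parity-∸ m≤n) (ℙₚ.+-comm (parity n) _))
... | inj₂ n≤m = trans (cong parity (trans (∣m⊖n∣≡∣n⊖m∣ m n) (∣⊖∣-≤ n≤m))) (parity-∸ n≤m)

parityℤ-homo-+ : ∀ i j → parityℤ (i ℤ.+ j) ≡ parityℤ i ℙ.+ parityℤ j
parityℤ-homo-+ (+ m)    (+ n)    = +-homo-+ m n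
parityℤ-homo-+ (+ m)    -[1+ n ] = parity-∣⊖∣ m (suc n)
parityℤ-homo-+ -[1+ m ] (+ n)    = trans (parity-∣⊖∣ n (suc m)) (ℙₚ.+-comm (parity n) _)
parityℤ-homo-+ -[1+ m ] -[1+ n ] = trans (cong (λ k → parity (suc k)) (sym (+-suc m n))) (+-homo-+ (suc m) (suc n))

parity-odd : ∀ k → parity (2 * k + 1) ≡ 1ℙ
parity-odd k = trans (+-homo-+ (2 * k) 1) (cong (ℙ._+ 1ℙ) (*-homo-* 2 k))

concatMap-map⁺ : ∀ {A B C : Set} {P : A → Set} {Q : B → Set} {R : C → Set}
  {f : A → B → C} {xs : List A} {ys : List B} →
  All P xs → All Q ys → (∀ x y → P x → Q y → R (f x y)) →
  All R (concatMap (λ x → map (f x) ys) xs)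
concatMap-map⁺ ps qs pq⇒r = concat⁺ (map⁺ (All.map (λ p → map⁺ (All.map (pq⇒r _ _ p) qs)) ps))

𝒱⁺ : ∀ {M N} {P : Vec ℤ N → Set} → All (λ v → weight v ≡ M → P v) (allTritVecs N) → All P (𝒱 M N)
𝒱⁺ {N = N} ps = All.zipWith (λ (w≡M , w≡M⇒p) → w≡M⇒p w≡M)
  (all-filter _ (allTritVecs N) , filter⁺ _ ps)

module ParityCharacter {N : ℕ} (χ : Vec ℤ N → Parity)
  (χ-homo : ∀ u v → χ (zipWith ℤ._+_ u v) ≡ χ u ℙ.+ χ v)
  (χ-0 : χ (replicate N (+ 0)) ≡ 0ℙ) where

  χ-vsum-sequences : ∀ {xs} → All (λ w → χ w ≡ 1ℙ) xs → ∀ n →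
    All (λ ws → χ (vsum ws) ≡ parity n) (sequences xs n)
  χ-vsum-sequences ps zero    = χ-0 ∷ []
  χ-vsum-sequences ps (suc n) = concatMap-map⁺ ps (χ-vsum-sequences ps n) χ-cons
    where
    χ-cons : ∀ w ws → χ w ≡ 1ℙ → χ (vsum ws) ≡ parity n → χ (vsum (w ∷ ws)) ≡ parity (suc n)
    χ-cons w ws χw χws = begin
      χ (zipWith ℤ._+_ w (vsum ws)) ≡⟨ χ-homo w (vsum ws) ⟩
      χ w ℙ.+ χ (vsum ws)           ≡⟨ cong₂ ℙ._+_ χw χws ⟩
      1ℙ ℙ.+ parity n               ≡⟨ sym (+-homo-+ 1 n) ⟩
      parity (suc n)                ∎
      where open ≡-Reasoning

  r-odd≡0 : ∀ {M} → All (λ w → χ w ≡ 1ℙ) (𝒱 M N) → ∀ n → r M N (2 * n + 1) ≡ 0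
  r-odd≡0 ps n =
    cong length (filter-none _ (All.map (λ {ws} → sum≢0 {ws}) (χ-vsum-sequences ps (2 * n + 1))))
    where
    sum≢0 : ∀ {ws} → χ (vsum ws) ≡ parity (2 * n + 1) → ¬ vsum ws ≡ replicate N (+ 0)
    sum≢0 χws sum≡0 = ℙₚ.p≢p⁻¹ 1ℙ (trans (sym (trans χws (parity-odd n))) (trans (cong χ sum≡0) χ-0))

parityΣ : ∀ {N} → Vec ℤ N → Parity
parityΣ []      = 0ℙ
parityΣ (x ∷ v) = parityℤ x ℙ.+ parityΣ v

parityΣ-homo : ∀ {N} (u v : Vec ℤ N) → parityΣ (zipWith ℤ._+_ u v) ≡ parityΣ u ℙ.+ parityΣ v
parityΣ-homo []      []      = refl
parityΣ-homo (x ∷ u) (y ∷ v) =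
  trans (cong₂ ℙ._+_ (parityℤ-homo-+ x y) (parityΣ-homo u v)) (interchange (parityℤ x) _ _ _)

parityΣ-replicate-0 : ∀ N → parityΣ (replicate N (+ 0)) ≡ 0ℙ
parityΣ-replicate-0 zero    = refl
parityΣ-replicate-0 (suc N) = parityΣ-replicate-0 N

parityΣ≡parity-weight : ∀ {N} (v : Vec ℤ N) → parityΣ v ≡ parity (weight v)
parityΣ≡parity-weight []      = refl
parityΣ≡parity-weight (x ∷ v) =
  trans (cong (parityℤ x ℙ.+_) (parityΣ≡parity-weight v)) (sym (+-homo-+ ∣ x ∣ (weight v)))

parityΣ-𝒱-odd : ∀ k N → All (λ v → parityΣ v ≡ 1ℙ) (𝒱 (2 * k + 1) N)
parityΣ-𝒱-odd k N = 𝒱⁺ (All.universal (λ v weight≡ →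
  trans (parityΣ≡parity-weight v) (trans (cong parity weight≡) (parity-odd k))) (allTritVecs N))

Bounded : ∀ {N} → Vec ℤ N → Set
Bounded = VecAll.All (λ x → ∣ x ∣ ≤ 1)

allTritVecs-bounded : ∀ N → All Bounded (allTritVecs N)
allTritVecs-bounded zero    = [] ∷ []
allTritVecs-bounded (suc N) = concatMap-map⁺ trits-bounded (allTritVecs-bounded N) (λ x _ → _∷_ {x = x})
  where
  trits-bounded : All (λ x → ∣ x ∣ ≤ 1) trits
  trits-bounded = s≤s z≤n ∷ z≤n ∷ s≤s z≤n ∷ []

weight≤length : ∀ {N} {v : Vec ℤ N} → Bounded v → weight v ≤ N
weight≤length []       = z≤n
weight≤length (b ∷ bs) = +-mono-≤ b (weight≤length bs)

∣head∣≡1 : ∀ {N} {v : Vec ℤ (suc N)} → Bounded v → weight v ≡ suc N → ∣ head v ∣ ≡ 1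
∣head∣≡1 {N} {x ∷ v} (b ∷ bs) weight≡ = ≤-antisym b (+-cancelʳ-≤ N 1 ∣ x ∣ 1+N≤∣x∣+N)
  where
  open ≤-Reasoning
  1+N≤∣x∣+N : 1 + N ≤ ∣ x ∣ + N
  1+N≤∣x∣+N = begin
    1 + N            ≡⟨ sym weight≡ ⟩
    ∣ x ∣ + weight v ≤⟨ +-mono-≤ ≤-refl (weight≤length bs) ⟩
    ∣ x ∣ + N        ∎

parity-head-𝒱-full : ∀ N → All (λ v → parityℤ (head v) ≡ 1ℙ) (𝒱 (suc N) (suc N))
parity-head-𝒱-full N =
  𝒱⁺ (All.map (λ bounded weight≡ → cong parity (∣head∣≡1 bounded weight≡)) (allTritVecs-bounded (suc N)))

parityℤ-head-homo : ∀ {N} (u v : Vec ℤ (suc N)) →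
  parityℤ (head (zipWith ℤ._+_ u v)) ≡ parityℤ (head u) ℙ.+ parityℤ (head v)
parityℤ-head-homo (x ∷ _) (y ∷ _) = parityℤ-homo-+ x y

proposition2p1 : (M N : ℕ) → 1 ≤ M → M ≤ N →
    ((∃ λ k → M ≡ 2 * k + 1) ⊎ M ≡ N) →
    (n : ℕ) → r M N (2 * n + 1) ≡ 0
proposition2p1 M N _ _ (inj₁ (k , refl)) =
  ParityCharacter.r-odd≡0 parityΣ parityΣ-homo (parityΣ-replicate-0 N) (parityΣ-𝒱-odd k N)
proposition2p1 (suc M) (suc .M) _ _ (inj₂ refl) =
  ParityCharacter.r-odd≡0 (λ v → parityℤ (head v)) parityℤ-head-homo refl (parity-head-𝒱-full M)
proposition2p1 zero _ () _ (inj₂ _)
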